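{- Let $k\ge 2$ and let $G_k$ be the vertex-weighted undirected graph defined below, with terminal set $T=A\cup D$, $A=\{a_1,\dots,a_k\}$, $D=\{d_1,\dots,d_k\}$. Let $i\neq j$ be indices in $\{1,\dots,k\}$ and let $X_{i,j}=\{a_i\}\cup(D\setminus\{d_j\})$. Then every minimum-weight $(X_{i,j},T\setminus X_{i,j})$-vertex-cut in $G_k$ contains $v_{i,j}$.
   Context: $G_k$ has terminals $a_1,\dots,a_k,d_1,\dots,d_k$ with weights $w(a_i)=2$, $w(d_i)=4$, an edge $\{a_i,d_i\}$ for each $i$, and for every unordered pair $\{i,j\}$ of distinct indices a non-terminal $v_{i,j}=v_{j,i}$ of weight $1$ adjacent to exactly $a_i$ and $a_j$. For vertex sets $P,Q$, a $(P,Q)$-vertex-cut is a set $C$ of vertices (possibly containing terminals) such that for all $p\in P\setminus C$, $q\in Q\setminus C$ there is no path from $p$ to $q$ in $G_k\setminus C$; its weight is $\sum_{v\in C}w(v)$, and a minimum cut is one of minimum weight. -}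

module Defs where

open import Data.Nat as ℕ using (ℕ; zero; suc; _+_; _≤_)
open import Data.Bool using (Bool; true; false; if_then_else_)
open import Data.Fin using (Fin; _<_; toℕ)
open import Data.Fin.Properties using (<-cmp)
open import Data.List using (List; []; _∷_; _++_; map; concatMap)
open import Data.Nat.ListAction using (sum)
open import Data.List using (allFin)
open import Data.Product using (Σ; _×_; _,_)
open import Data.Sum using (_⊎_)
open import Data.Empty using (⊥-elim)
open import Relation.Nullary using (¬_; yes; no)
open import Relation.Binary using (tri<; tri≈; tri>)
open import Relation.Binary.PropositionalEquality using (_≡_; _≢_)

-- Vertices of G_k.  The non-terminal v_{i,j} = v_{j,i} is represented once,
-- by the ordered pair with i < j.
data V (k : ℕ) : Set where
  a : Fin k → V k
  d : Fin k → V k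
  v : (i j : Fin k) → i < j → V k

w : {k : ℕ} → V k → ℕ
w (a _)     = 2
w (d _)     = 4
w (v _ _ _) = 1

vp : {k : ℕ} (i j : Fin k) → i ≢ j → V k
vp i j i≢j with <-cmp i j
... | tri< p _ _ = v i j p
... | tri≈ _ e _ = ⊥-elim (i≢j e)
... | tri> _ _ q = v j i q

data Adj {k : ℕ} : V k → V k → Set where
  ad : (i : Fin k) → Adj (a i) (d i)
  da : (i : Fin k) → Adj (d i) (a i)
  va₁ : (i j : Fin k) (p : i < j) → Adj (v i j p) (a i)
  va₂ : (i j : Fin k) (p : i < j) → Adj (v i j p) (a j)
  av₁ : (i j : Fin k) (p : i < j) → Adj (a i) (v i j p)
  av₂ : (i j : Fin k) (p : i < j) → Adj (a j) (v i j p)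

VSet : ℕ → Set
VSet k = V k → Bool

pairsFrom : {k : ℕ} → Fin k → List (V k)
pairsFrom {k} i = concatMap (λ j → f j) (allFin k)
  where
  f : Fin k → List (V k)
  f j with toℕ i ℕ.<? toℕ j
  ... | yes p = v i j p ∷ []
  ... | no _  = []

allV : (k : ℕ) → List (V k)
allV k = map a (allFin k) ++ map d (allFin k) ++ concatMap pairsFrom (allFin k)

weight : {k : ℕ} → VSet k → ℕ
weight {k} C = sum (map (λ x → if C x then w x else 0) (allV k))

data PathAvoiding {k : ℕ} (C : VSet k) : V k → V k → Set where
  here : ∀ {x} → C x ≡ false → PathAvoiding C x x
  step : ∀ {x y z} → C x ≡ false → Adj x y → PathAvoiding C y z → PathAvoiding C x z

IsVertexCut : {k : ℕ} → (V k → Set) → (V k → Set) → VSet k → Set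
IsVertexCut {k} P Q C =
  ∀ (p q : V k) → P p → Q q → C p ≡ false → C q ≡ false → ¬ PathAvoiding C p q

IsMinVertexCut : {k : ℕ} → (V k → Set) → (V k → Set) → VSet k → Set
IsMinVertexCut {k} P Q C =
  IsVertexCut P Q C × (∀ (C' : VSet k) → IsVertexCut P Q C' → weight C ≤ weight C')

data Terminal {k : ℕ} : V k → Set where
  isA : (i : Fin k) → Terminal (a i)
  isD : (i : Fin k) → Terminal (d i)

data InX {k : ℕ} (i j : Fin k) : V k → Set where
  xa : InX i j (a i)
  xd : (l : Fin k) → l ≢ j → InX i j (d l)

InTminusX : {k : ℕ} (i j : Fin k) → V k → Set
InTminusX i j x = Terminal x × ¬ InX i j x

-- Every (X, T ∖ X)-cut C must separate d_l from a_l for each l ∉ {i, j}, which costs at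
-- least 2 per such l.  If C misses v_{i,j}, it must also separate a_i from a_j along the
-- path a_i – v_{i,j} – a_j, which costs another 2, so w(C) ≥ 2(k − 1).  But
-- {a_l | l ∉ {i, j}} ∪ {v_{i,j}} is a cut of weight 2(k − 2) + 1, so C is not minimum.
module Submission where

open import Defs
open import Data.Bool using (true; false; not; if_then_else_)
open import Data.Bool.Properties using (not-injective; not-¬)
open import Data.Empty using (⊥; ⊥-elim)
open import Data.Fin using (Fin; zero; suc; toℕ; _≟_; punchIn) renaming (_<_ to _<ᶠ_)
open import Data.Fin.Properties using (<-cmp; <-irrefl; <-asym; <-irrelevant; punchInᵢ≢i)
open import Data.List using (List; []; _∷_; _++_; map; concatMap; tabulate; allFin)
open import Data.List.Properties using (map-++; map-∘; map-tabulate)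
open import Data.Nat using (ℕ; zero; suc; _+_; _≤_; _<_; z≤n; s≤s; _<?_)
open import Data.Nat.ListAction using (sum)
open import Data.Nat.ListAction.Properties using (sum-++)
open import Data.Nat.Properties
  using (+-0-commutativeMonoid; +-assoc; +-comm; +-identityʳ; +-mono-≤; ≤-reflexive; ≤-trans;
         m≤m+n; m≤n+m; n<1+n; <⇒≱; module ≤-Reasoning)
open import Algebra.Properties.CommutativeMonoid.Sum +-0-commutativeMonoid
  using (sum-remove; ∑-distrib-+; sum-cong-≗; sum-replicate-zero; sum-syntax)
  renaming (sum to ∑)
open import Data.Product using (Σ; _×_; _,_; proj₁; proj₂)
open import Data.Sum using (_⊎_; inj₁; inj₂; swap)
open import Data.Vec.Functional using (Vector)
open import Function using (_∘_)
open import Relation.Binary using (tri<; tri≈; tri>)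
open import Relation.Binary.PropositionalEquality
open import Relation.Nullary using (¬_; Dec; yes; no; does; contradiction)
open import Relation.Nullary.Decidable using (dec-true; dec-false; _×-dec_; _⊎-dec_)

private
  variable
    A B : Set
    k n : ℕ

does⇒ : (a? : Dec A) → does a? ≡ true → A
does⇒ (yes x) _ = x

∑-zero : {f : Vector ℕ n} → (∀ l → f l ≡ 0) → ∑ f ≡ 0
∑-zero {n} f≡0 = trans (sum-cong-≗ f≡0) (sum-replicate-zero n)

∑-concentrated : {f : Vector ℕ n} (m : Fin n) → (∀ l → l ≢ m → f l ≡ 0) → ∑ f ≡ f m
∑-concentrated {suc n} {f} m f-vanishes = begin
  ∑ f                         ≡⟨ sum-remove f ⟩
  f m + ∑ (f ∘ punchIn m)     ≡⟨ cong (f m +_) (∑-zero (λ l → f-vanishes _ (punchInᵢ≢i m l))) ⟩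
  f m + 0                     ≡⟨ +-identityʳ (f m) ⟩
  f m                         ∎
  where open ≡-Reasoning

∑-mono-≤ : {f g : Vector ℕ n} → (∀ l → f l ≤ g l) → ∑ f ≤ ∑ g
∑-mono-≤ {zero}  f≤g = z≤n
∑-mono-≤ {suc n} f≤g = +-mono-≤ (f≤g zero) (∑-mono-≤ (f≤g ∘ suc))

∑-mono-≤-gap : {f g : Vector ℕ n} (e : ℕ) (m : Fin n) →
               (∀ l → f l ≤ g l) → e + f m ≤ g m → e + ∑ f ≤ ∑ g
∑-mono-≤-gap {suc n} {f} {g} e m f≤g gap = begin
  e + ∑ f                        ≡⟨ cong (e +_) (sum-remove f) ⟩
  e + (f m + ∑ (f ∘ punchIn m))  ≡⟨ +-assoc e (f m) _ ⟨
  e + f m + ∑ (f ∘ punchIn m)    ≤⟨ +-mono-≤ gap (∑-mono-≤ (f≤g ∘ punchIn m)) ⟩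
  g m + ∑ (g ∘ punchIn m)        ≡⟨ sum-remove g ⟨
  ∑ g                            ∎
  where open ≤-Reasoning

sum-map-++ : (f : A → ℕ) (xs ys : List A) → sum (map f (xs ++ ys)) ≡ sum (map f xs) + sum (map f ys)
sum-map-++ f xs ys = trans (cong sum (map-++ f xs ys)) (sum-++ (map f xs) (map f ys))

sum-map-concatMap : (f : B → ℕ) (g : A → List B) (xs : List A) →
                    sum (map f (concatMap g xs)) ≡ sum (map (λ x → sum (map f (g x))) xs)
sum-map-concatMap f g []       = refl
sum-map-concatMap f g (x ∷ xs) =
  trans (sum-map-++ f (g x) (concatMap g xs)) (cong (sum (map f (g x)) +_) (sum-map-concatMap f g xs))

sum-tabulate : (f : Vector ℕ n) → sum (tabulate f) ≡ ∑ f
sum-tabulate {zero}  f = refl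
sum-tabulate {suc n} f = cong (f zero +_) (sum-tabulate (f ∘ suc))

sum-map-allFin : (f : Fin n → ℕ) → sum (map f (allFin n)) ≡ ∑[ l < n ] f l
sum-map-allFin f = trans (cong sum (map-tabulate (λ l → l) f)) (sum-tabulate f)

sum-map-map-allFin : (f : B → ℕ) (g : Fin n → B) → sum (map f (map g (allFin n))) ≡ ∑[ l < n ] f (g l)
sum-map-map-allFin f g = trans (cong sum (sym (map-∘ {g = f} {f = g} (allFin _)))) (sum-map-allFin (f ∘ g))

-- The per-q piece of `pairsFrom p` is local to its definition; unification recovers it.
pairsFrom-pieces : (p : Fin k) → Σ (Fin k → List (V k)) λ piece → pairsFrom p ≡ concatMap piece (allFin k)
pairsFrom-pieces p = _ , refl

pairPiece : Fin k → Fin k → List (V k)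
pairPiece p = proj₁ (pairsFrom-pieces p)

data PairPiece (p q : Fin k) : List (V k) → Set where
  present : (p<q : p <ᶠ q) → PairPiece p q (v p q p<q ∷ [])
  absent  : ¬ p <ᶠ q → PairPiece p q []

pairPiece-view : (p q : Fin k) → PairPiece p q (pairPiece p q)
pairPiece-view p q with toℕ p <? toℕ q
... | yes p<q = present p<q
... | no  p≮q = absent p≮q

pairSum : (V k → ℕ) → ℕ
pairSum {k} h = sum (map h (concatMap pairsFrom (allFin k)))

pieceSum : (V k → ℕ) → Fin k → Fin k → ℕ
pieceSum h p q = sum (map h (pairPiece p q))

pairSum-∑∑ : (h : V k → ℕ) → pairSum h ≡ ∑[ p < k ] ∑[ q < k ] pieceSum h p q
pairSum-∑∑ {k} h = begin
  pairSum h
    ≡⟨ sum-map-concatMap h pairsFrom (allFin k) ⟩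
  sum (map (λ p → sum (map h (pairsFrom p))) (allFin k))
    ≡⟨ sum-map-allFin (λ p → sum (map h (pairsFrom p))) ⟩
  ∑[ p < k ] sum (map h (pairsFrom p))
    ≡⟨ sum-cong-≗ (λ p → sum-map-concatMap h (pairPiece p) (allFin k)) ⟩
  ∑[ p < k ] sum (map (pieceSum h p) (allFin k))
    ≡⟨ sum-cong-≗ (λ p → sum-map-allFin (pieceSum h p)) ⟩
  ∑[ p < k ] ∑[ q < k ] pieceSum h p q
    ∎
  where open ≡-Reasoning

pairSum-concentrated : {p₀ q₀ : Fin k} (p₀<q₀ : p₀ <ᶠ q₀) (h : V k → ℕ) →
                       (∀ {p q} (p<q : p <ᶠ q) → ¬ (p ≡ p₀ × q ≡ q₀) → h (v p q p<q) ≡ 0) →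
                       pairSum h ≡ h (v p₀ q₀ p₀<q₀)
pairSum-concentrated {k} {p₀} {q₀} p₀<q₀ h h-vanishes = begin
  pairSum h                              ≡⟨ pairSum-∑∑ h ⟩
  ∑[ p < k ] ∑[ q < k ] pieceSum h p q   ≡⟨ ∑-concentrated p₀ off-row ⟩
  ∑[ q < k ] pieceSum h p₀ q             ≡⟨ ∑-concentrated q₀ off-column ⟩
  pieceSum h p₀ q₀                       ≡⟨ piece-at (pairPiece-view p₀ q₀) ⟩
  h (v p₀ q₀ p₀<q₀)                      ∎
  where
  open ≡-Reasoning

  piece-vanishes : ∀ {p q L} → PairPiece p q L → ¬ (p ≡ p₀ × q ≡ q₀) → sum (map h L) ≡ 0
  piece-vanishes (present p<q) ≢₀ = cong (_+ 0) (h-vanishes p<q ≢₀)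
  piece-vanishes (absent _)    _  = refl

  off-row : ∀ p → p ≢ p₀ → ∑[ q < k ] pieceSum h p q ≡ 0
  off-row p p≢p₀ = ∑-zero (λ q → piece-vanishes (pairPiece-view p q) (p≢p₀ ∘ proj₁))

  off-column : ∀ q → q ≢ q₀ → pieceSum h p₀ q ≡ 0
  off-column q q≢q₀ = piece-vanishes (pairPiece-view p₀ q) (q≢q₀ ∘ proj₂)

  piece-at : ∀ {L} → PairPiece p₀ q₀ L → sum (map h L) ≡ h (v p₀ q₀ p₀<q₀)
  piece-at (present p<q) = trans (+-identityʳ _) (cong (h ∘ v p₀ q₀) (<-irrelevant p<q p₀<q₀))
  piece-at (absent p≮q)  = contradiction p₀<q₀ p≮q

contribution : VSet k → V k → ℕ
contribution C x = if C x then w x else 0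

terminalWeight : VSet k → Fin k → ℕ
terminalWeight C l = contribution C (a l) + contribution C (d l)

weight-split : (C : VSet k) → weight C ≡ ∑[ l < k ] terminalWeight C l + pairSum (contribution C)
weight-split {k} C = begin
  weight C                                  ≡⟨ sum-map-++ h (map a fins) _ ⟩
  Σh (map a fins) + Σh (map d fins ++ ps)   ≡⟨ cong (Σh (map a fins) +_) (sum-map-++ h (map d fins) ps) ⟩
  Σh (map a fins) + (Σh (map d fins) + P)   ≡⟨ +-assoc (Σh (map a fins)) _ P ⟨
  Σh (map a fins) + Σh (map d fins) + P
    ≡⟨ cong (_+ P) (cong₂ _+_ (sum-map-map-allFin h a) (sum-map-map-allFin h d)) ⟩
  ∑ (h ∘ a) + ∑ (h ∘ d) + P                 ≡⟨ cong (_+ P) (∑-distrib-+ (h ∘ a) (h ∘ d)) ⟨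
  ∑[ l < k ] terminalWeight C l + P         ∎
  where
  open ≡-Reasoning
  h    = contribution C
  Σh   = λ (xs : List (V k)) → sum (map h xs)
  fins = allFin k
  ps   = concatMap pairsFrom fins
  P    = pairSum h

terminalWeight-≥2 : (C : VSet k) (l : Fin k) → C (a l) ≡ true ⊎ C (d l) ≡ true → 2 ≤ terminalWeight C l
terminalWeight-≥2 C l (inj₁ al∈C) rewrite al∈C = m≤m+n 2 (contribution C (d l))
terminalWeight-≥2 C l (inj₂ dl∈C) rewrite dl∈C = ≤-trans (s≤s (s≤s z≤n)) (m≤n+m 4 (contribution C (a l)))

avoiding-start : {C : VSet k} {x y : V k} → PathAvoiding C x y → C x ≡ false
avoiding-start (here x∉C)     = x∉C
avoiding-start (step x∉C _ _) = x∉C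

module _ {P Q : V k → Set} {C : VSet k} (isCut : IsVertexCut P Q C) where

  cut-meets-edge : ∀ {p q} → P p → Q q → Adj p q → C p ≡ true ⊎ C q ≡ true
  cut-meets-edge {p} {q} Pp Qq p~q with C p in p∉C | C q in q∉C
  ... | true  | _     = inj₁ refl
  ... | false | true  = inj₂ refl
  ... | false | false = ⊥-elim (isCut p q Pp Qq p∉C q∉C (step p∉C p~q (here q∉C)))

  cut-meets-path₂ : ∀ {p x q} → P p → Q q → Adj p x → Adj x q → C x ≡ false → C p ≡ true ⊎ C q ≡ true
  cut-meets-path₂ {p} {x} {q} Pp Qq p~x x~q x∉C with C p in p∉C | C q in q∉C
  ... | true  | _     = inj₁ refl
  ... | false | true  = inj₂ refl
  ... | false | false = ⊥-elim (isCut p q Pp Qq p∉C q∉C (step p∉C p~x (step x∉C x~q (here q∉C))))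

module _ {i j : Fin k} (i≢j : i ≢ j) where

  vp-adjacentˡ : Adj (a i) (vp i j i≢j)
  vp-adjacentˡ with <-cmp i j
  ... | tri< i<j _ _ = av₁ i j i<j
  ... | tri≈ _ i≡j _ = contradiction i≡j i≢j
  ... | tri> _ _ j<i = av₂ j i j<i

  vp-adjacentʳ : Adj (vp i j i≢j) (a j)
  vp-adjacentʳ with <-cmp i j
  ... | tri< i<j _ _ = va₂ i j i<j
  ... | tri≈ _ i≡j _ = contradiction i≡j i≢j
  ... | tri> _ _ j<i = va₁ j i j<i

module PairCut {i j : Fin k} (i≢j : i ≢ j) where

  IsEnd : Fin k → Set
  IsEnd l = l ≡ i ⊎ l ≡ j

  Joins : Fin k → Fin k → Set
  Joins p q = (p ≡ i × q ≡ j) ⊎ (p ≡ j × q ≡ i)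

  isEnd? : (l : Fin k) → Dec (IsEnd l)
  isEnd? l = l ≟ i ⊎-dec l ≟ j

  joins? : (p q : Fin k) → Dec (Joins p q)
  joins? p q = (p ≟ i ×-dec q ≟ j) ⊎-dec (p ≟ j ×-dec q ≟ i)

  C₀ : VSet k
  C₀ (a l)     = not (does (isEnd? l))
  C₀ (d _)     = false
  C₀ (v p q _) = does (joins? p q)

  C₀-a-ends : ∀ {l} → IsEnd l → C₀ (a l) ≡ false
  C₀-a-ends {l} end = cong not (dec-true (isEnd? l) end)

  C₀-a-false : ∀ l → C₀ (a l) ≡ false → IsEnd l
  C₀-a-false l al∉C₀ = does⇒ (isEnd? l) (not-injective al∉C₀)

  joins-ends : ∀ {p q} → IsEnd p → IsEnd q → p <ᶠ q → Joins p q
  joins-ends (inj₁ refl) (inj₂ refl) _   = inj₁ (refl , refl)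
  joins-ends (inj₂ refl) (inj₁ refl) _   = inj₂ (refl , refl)
  joins-ends (inj₁ refl) (inj₁ refl) p<p = contradiction p<p (<-irrefl refl)
  joins-ends (inj₂ refl) (inj₂ refl) p<p = contradiction p<p (<-irrefl refl)

  C₀-pair-blocked : ∀ {p q} (p<q : p <ᶠ q) →
                    C₀ (v p q p<q) ≡ false → C₀ (a p) ≡ false → C₀ (a q) ≡ false → ⊥
  C₀-pair-blocked {p} {q} p<q pq∉C₀ ap∉C₀ aq∉C₀ =
    not-¬ (dec-true (joins? p q) (joins-ends (C₀-a-false p ap∉C₀) (C₀-a-false q aq∉C₀) p<q)) pq∉C₀

  data SourceSide : V k → Set where
    a-side  : SourceSide (a i)
    d-side  : ∀ {l} → l ≢ j → SourceSide (d l)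
    v-sideˡ : ∀ {q} (i<q : i <ᶠ q) → SourceSide (v i q i<q)
    v-sideʳ : ∀ {p} (p<i : p <ᶠ i) → SourceSide (v p i p<i)

  sourceSide-step : ∀ {x y} → SourceSide x → C₀ x ≡ false → Adj x y → C₀ y ≡ false → SourceSide y
  sourceSide-step a-side        _   (ad _)       _   = d-side i≢j
  sourceSide-step a-side        _   (av₁ _ _ i<q) _  = v-sideˡ i<q
  sourceSide-step a-side        _   (av₂ _ _ p<i) _  = v-sideʳ p<i
  sourceSide-step (d-side l≢j)  _   (da l)       al∉C₀ with C₀-a-false l al∉C₀
  ... | inj₁ refl = a-side
  ... | inj₂ l≡j  = contradiction l≡j l≢j
  sourceSide-step (v-sideˡ i<q) _   (va₁ _ _ _)  _     = a-side
  sourceSide-step (v-sideˡ i<q) x∉C₀ (va₂ _ _ _) aq∉C₀ =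
    ⊥-elim (C₀-pair-blocked i<q x∉C₀ (C₀-a-ends (inj₁ refl)) aq∉C₀)
  sourceSide-step (v-sideʳ p<i) x∉C₀ (va₁ _ _ _) ap∉C₀ =
    ⊥-elim (C₀-pair-blocked p<i x∉C₀ ap∉C₀ (C₀-a-ends (inj₁ refl)))
  sourceSide-step (v-sideʳ p<i) _   (va₂ _ _ _)  _     = a-side

  sourceSide-closed : ∀ {x y} → SourceSide x → PathAvoiding C₀ x y → SourceSide y
  sourceSide-closed side (here _)            = side
  sourceSide-closed side (step x∉C₀ x~y path) =
    sourceSide-closed (sourceSide-step side x∉C₀ x~y (avoiding-start path)) path

  C₀-isCut : IsVertexCut (InX i j) (InTminusX i j) C₀
  C₀-isCut p q p∈X (q-terminal , q∉X) _ _ path =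
    q∉X (terminal-in-X q-terminal (sourceSide-closed (X-side p∈X) path))
    where
    X-side : ∀ {x} → InX i j x → SourceSide x
    X-side xa          = a-side
    X-side (xd l l≢j)  = d-side l≢j

    terminal-in-X : ∀ {y} → Terminal y → SourceSide y → InX i j y
    terminal-in-X (isA _) a-side       = xa
    terminal-in-X (isD l) (d-side l≢j) = xd l l≢j

  C₀-pair-support : ∀ {p₀ q₀} (p₀<q₀ : p₀ <ᶠ q₀) → Joins p₀ q₀ →
                    ∀ {p q} (p<q : p <ᶠ q) → ¬ (p ≡ p₀ × q ≡ q₀) → contribution C₀ (v p q p<q) ≡ 0
  C₀-pair-support {p₀} {q₀} p₀<q₀ joins₀ {p} {q} p<q ≢₀ =
    cong (λ b → if b then 1 else 0) (dec-false (joins? p q) (¬joins joins₀))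
    where
    ¬joins : Joins p₀ q₀ → ¬ Joins p q
    ¬joins (inj₁ (refl , refl)) (inj₁ (refl , refl)) = ≢₀ (refl , refl)
    ¬joins (inj₂ (refl , refl)) (inj₂ (refl , refl)) = ≢₀ (refl , refl)
    ¬joins (inj₂ (refl , refl)) (inj₁ (refl , refl)) = <-asym p₀<q₀ p<q
    ¬joins (inj₁ (refl , refl)) (inj₂ (refl , refl)) = <-asym p₀<q₀ p<q

  C₀-pairSum-at : ∀ {p₀ q₀} (p₀<q₀ : p₀ <ᶠ q₀) → Joins p₀ q₀ → pairSum (contribution C₀) ≡ 1
  C₀-pairSum-at {p₀} {q₀} p₀<q₀ joins₀ =
    trans (pairSum-concentrated p₀<q₀ _ (C₀-pair-support p₀<q₀ joins₀))
          (cong (λ b → if b then 1 else 0) (dec-true (joins? p₀ q₀) joins₀))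

  C₀-pairSum : pairSum (contribution C₀) ≡ 1
  C₀-pairSum with <-cmp i j
  ... | tri< i<j _ _ = C₀-pairSum-at i<j (inj₁ (refl , refl))
  ... | tri≈ _ i≡j _ = contradiction i≡j i≢j
  ... | tri> _ _ j<i = C₀-pairSum-at j<i (inj₂ (refl , refl))

  C₀-terminalWeight-ends : ∀ {l} → IsEnd l → terminalWeight C₀ l ≡ 0
  C₀-terminalWeight-ends end rewrite C₀-a-ends end = refl

  C₀-terminalWeight-inner : ∀ {l} → ¬ IsEnd l → terminalWeight C₀ l ≡ 2
  C₀-terminalWeight-inner {l} ¬end = cong (λ b → (if not b then 2 else 0) + 0) (dec-false (isEnd? l) ¬end)

  module _ {C : VSet k} (isCut : IsVertexCut (InX i j) (InTminusX i j) C) where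

    cut-covers-inner : ∀ {l} → ¬ IsEnd l → C (a l) ≡ true ⊎ C (d l) ≡ true
    cut-covers-inner {l} ¬end =
      swap (cut-meets-edge isCut (xd l (¬end ∘ inj₂)) (isA l , λ { xa → ¬end (inj₁ refl) }) (da l))

    cut-covers-ends : C (vp i j i≢j) ≡ false → C (a i) ≡ true ⊎ C (a j) ≡ true
    cut-covers-ends x∉C =
      cut-meets-path₂ isCut xa (isA j , λ { xa → i≢j refl }) (vp-adjacentˡ i≢j) (vp-adjacentʳ i≢j) x∉C

    C₀-terminalWeight-≤ : ∀ l → terminalWeight C₀ l ≤ terminalWeight C l
    C₀-terminalWeight-≤ l with isEnd? l
    ... | yes end  = ≤-trans (≤-reflexive (C₀-terminalWeight-ends end)) z≤n
    ... | no  ¬end =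
      ≤-trans (≤-reflexive (C₀-terminalWeight-inner ¬end)) (terminalWeight-≥2 C l (cut-covers-inner ¬end))

    C₀-terminalWeight-gap : ∀ {m} → IsEnd m → C (a m) ≡ true → 2 + terminalWeight C₀ m ≤ terminalWeight C m
    C₀-terminalWeight-gap {m} end am∈C rewrite C₀-terminalWeight-ends end = terminalWeight-≥2 C m (inj₁ am∈C)

    C₀-terminal-gap : C (vp i j i≢j) ≡ false →
                      2 + ∑[ l < k ] terminalWeight C₀ l ≤ ∑[ l < k ] terminalWeight C l
    C₀-terminal-gap x∉C with cut-covers-ends x∉C
    ... | inj₁ ai∈C = ∑-mono-≤-gap 2 i C₀-terminalWeight-≤ (C₀-terminalWeight-gap (inj₁ refl) ai∈C)
    ... | inj₂ aj∈C = ∑-mono-≤-gap 2 j C₀-terminalWeight-≤ (C₀-terminalWeight-gap (inj₂ refl) aj∈C)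

    C₀-lighter : C (vp i j i≢j) ≡ false → weight C₀ < weight C
    C₀-lighter x∉C = begin-strict
      weight C₀                      ≡⟨ weight-split C₀ ⟩
      T₀ + pairSum (contribution C₀) ≡⟨ cong (T₀ +_) C₀-pairSum ⟩
      T₀ + 1                         ≡⟨ +-comm T₀ 1 ⟩
      1 + T₀                         <⟨ n<1+n (1 + T₀) ⟩
      2 + T₀                         ≤⟨ C₀-terminal-gap x∉C ⟩
      T                              ≤⟨ m≤m+n T _ ⟩
      T + pairSum (contribution C)   ≡⟨ weight-split C ⟨
      weight C                       ∎
      where
      open ≤-Reasoning
      T₀ = ∑[ l < k ] terminalWeight C₀ l
      T  = ∑[ l < k ] terminalWeight C l

lemma4p3 : (k : ℕ) → 2 ≤ k → (i j : Fin k) → (i≢j : i ≢ j) →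
    (C : VSet k) → IsMinVertexCut (InX i j) (InTminusX i j) C →
    C (vp i j i≢j) ≡ true
lemma4p3 k _ i j i≢j C (isCut , minimal) with C (vp i j i≢j) in x∉C
... | true  = refl
... | false = contradiction (minimal C₀ C₀-isCut) (<⇒≱ (C₀-lighter isCut x∉C))
  where open PairCut i≢j
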